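{- Let $\mathcal{M}$ be a $2$-divisible multiset of points in $\mathrm{PG}(v-1,2)$ with cardinality $6$. Then either $\mathcal{M}$ contains a point of multiplicity at least two, or $\mathcal{M}$ is the characteristic function of a projective base of size $6$, or $\mathcal{M}=\chi_{L_1}+\chi_{L_2}$ for two disjoint lines $L_1,L_2$.
   Context: $\mathrm{PG}(v-1,2)$ is the projective geometry of $\mathbb{F}_2^v$; points, lines, hyperplanes are subspaces of dimension $1$, $2$, $v-1$. A multiset of points $\mathcal{M}$ assigns to each point $P$ a multiplicity $\mathcal{M}(P)\in\{0,1,2,\dots\}$; $\mathcal{M}(K)=\sum_{P\le K}\mathcal{M}(P)$ for a subspace $K$, and $\#\mathcal{M}=\mathcal{M}(\mathbb{F}_2^v)$. $\mathcal{M}$ is $\Delta$-divisible if $\mathcal{M}(H)\equiv\#\mathcal{M}\pmod\Delta$ for every hyperplane $H$. For a subspace or set of points $K$, $\chi_K$ has multiplicity $1$ on the points of $K$ and $0$ elsewhere. A projective base of size $n$ is a set of $n$ points such that any $n-1$ of them span an $(n-1)$-dimensional subspace. -}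

module Defs where

open import Data.Bool using (Bool; true; false; not; _xor_; _∧_; _∨_)
open import Data.Nat using (ℕ; zero; suc; _+_; _%_)
open import Data.Fin using (Fin)
open import Data.List using (List; []; _∷_; _++_; map; filterᵇ; length; filter)
open import Data.Nat.ListAction using (sum)
open import Data.List.Membership.Propositional using (_∈_)
open import Data.Vec using (Vec; []; _∷_; replicate; zipWith; removeAt; toList)
open import Data.Vec.Properties using (≡-dec)
import Data.Bool.Properties as BP
open import Relation.Binary.PropositionalEquality using (_≡_; _≢_)
open import Relation.Binary.Definitions using (DecidableEquality)
open import Data.Empty using (⊥)

-- Vectors of F₂^v, with F₂ = Bool (false = 0, true = 1, addition = xor).
Vect : ℕ → Set
Vect v = Vec Bool v

_≟V_ : ∀ {v} → DecidableEquality (Vect v)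
_≟V_ = ≡-dec BP._≟_

zeroV : ∀ v → Vect v
zeroV v = replicate v false

_⊕_ : ∀ {v} → Vect v → Vect v → Vect v
_⊕_ = zipWith _xor_

-- A point of PG(v-1,2) is a 1-dimensional subspace of F₂^v, which is
-- identified with its unique nonzero vector.
isNonzero : ∀ {v} → Vect v → Bool
isNonzero [] = false
isNonzero (x ∷ xs) = x ∨ isNonzero xs

allVects : (v : ℕ) → List (Vect v)
allVects zero = [] ∷ []
allVects (suc v) = map (false ∷_) (allVects v) ++ map (true ∷_) (allVects v)

points : (v : ℕ) → List (Vect v)
points v = filterᵇ isNonzero (allVects v)

-- A multiset of points: a multiplicity for every point.  The value at the
-- zero vector is irrelevant (never used: all sums/quantifiers range over points).
Multiset : ℕ → Set
Multiset v = Vect v → ℕ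

mass : ∀ {v} → Multiset v → List (Vect v) → ℕ
mass M K = sum (map M K)

card : ∀ {v} → Multiset v → ℕ
card {v} M = mass M (points v)

dot : ∀ {v} → Vect v → Vect v → Bool
dot [] [] = false
dot (a ∷ as) (x ∷ xs) = (a ∧ x) xor dot as xs

-- Hyperplanes of PG(v-1,2) are exactly the kernels a^⊥ of nonzero a;
-- the points of the hyperplane a^⊥:
hyperplanePoints : ∀ {v} → Vect v → List (Vect v)
hyperplanePoints {v} a = filterᵇ (λ x → not (dot a x)) (points v)

Divisible : ∀ {v} → (Δ : ℕ) → .{{_ : Data.Nat.NonZero Δ}} → Multiset v → Set
Divisible {v} Δ M =
  ∀ (a : Vect v) → isNonzero a ≡ true →
    mass M (hyperplanePoints a) % Δ ≡ card M % Δ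

lincomb : ∀ {v k} → Vec Bool k → Vec (Vect v) k → Vect v
lincomb {v} [] [] = zeroV v
lincomb (false ∷ cs) (x ∷ xs) = lincomb cs xs
lincomb (true ∷ cs) (x ∷ xs) = x ⊕ lincomb cs xs

LinIndep : ∀ {v k} → Vec (Vect v) k → Set
LinIndep {v} {k} xs = ∀ (c : Vec Bool k) → lincomb c xs ≡ zeroV v → c ≡ replicate k false

-- A projective base of size n+1: any n of the points span an n-dimensional
-- subspace, i.e. any n of the (vectors representing the) points are linearly
-- independent.
ProjectiveBase : ∀ {v n} → Vec (Vect v) (suc n) → Set
ProjectiveBase {n = n} b = ∀ (i : Fin (suc n)) → LinIndep (removeAt b i)

-- characteristic function χ_K of a set K of points given as a list
-- (multiplicity = number of occurrences; equals the indicator for lists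
-- without repetitions)
χ : ∀ {v} → List (Vect v) → Multiset v
χ K P = length (filter (P ≟V_) K)

linePoints : ∀ {v} → Vect v → Vect v → List (Vect v)
linePoints a b = a ∷ b ∷ (a ⊕ b) ∷ []

Disjoint : ∀ {v} → List (Vect v) → List (Vect v) → Set
Disjoint K L = ∀ P → P ∈ K → P ∈ L → ⊥

-- If no point has multiplicity ≥ 2, then M is the characteristic
-- function of the set S of its points of odd multiplicity, and #S = 6.  For
-- every nonzero a, the parity of the number of points of S off the hyperplane
-- a^⊥ is ⟨a, ΣS⟩; 2-divisibility makes that number even, so ΣS = 0.
-- A linear dependency among the points of S splits S into two parts of zero
-- sum, and a nonempty zero-sum set of distinct nonzero vectors has at least
-- three elements; so the parts have sizes 0 + 6 or 3 + 3.  If some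
-- dependency has parts 3 + 3, each part {a, b, e} has e = a + b and is a
-- line, giving two disjoint lines.  Otherwise the only dependencies are the
-- empty one and ΣS = 0, so any five of the six points are independent.
module Submission where

open import Defs
open import Algebra.Bundles using (CommutativeRing)
open import Data.Bool using (Bool; true; false; not; _xor_; _∧_)
open import Data.Bool.Properties using (xor-assoc; xor-comm; xor-identityˡ; xor-identityʳ; xor-same; not-distribˡ-xor; ∧-distribˡ-xor; not-involutive; xor-∧-commutativeRing; T-≡)
import Data.Bool.Properties as Bool
open import Algebra.Properties.CommutativeSemigroup (CommutativeRing.+-commutativeSemigroup xor-∧-commutativeRing) using (interchange)
open import Data.Nat using (ℕ; zero; suc; _+_; _*_; _≤_; z≤n; s≤s; _≤?_; _≟_)
open import Data.Nat.Properties using (n≤0⇒n≡0; ≤-pred; ≤-antisym; ≤-trans; ≤-reflexive; m≤m+n; m≤n+m; n≮0; ≰⇒>; +-assoc; +-cancelˡ-≡; +-cancelˡ-≤; +-cancelʳ-≤; +-mono-≤; +-monoʳ-≤; +-commutativeSemigroup)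
open import Algebra.Properties.CommutativeSemigroup +-commutativeSemigroup using () renaming (x∙yz≈y∙xz to +-leftComm)
open import Data.Nat.Divisibility using (_∣_; divides; ∣m+n∣m⇒∣n; m%n≡0⇒n∣m; n∣m⇒m%n≡0)
open import Data.Nat.ListAction using (sum)
open import Data.Fin using (Fin; zero; suc)
open import Data.List using (List; []; _∷_; _++_; map; filterᵇ; filter; length; foldr)
open import Data.List.Properties using (filter-++; length-++; filter-accept; filter-reject)
open import Data.List.Membership.Propositional using (_∈_)
open import Data.List.Membership.Propositional.Properties using (∈-filter⁺; ∈-length)
open import Data.List.Relation.Unary.Any using (here; there)
open import Data.List.Relation.Unary.All using (All; []; _∷_)
import Data.List.Relation.Unary.All as All
open import Data.List.Relation.Unary.All.Properties using (all-filter)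
open import Data.List.Relation.Binary.Permutation.Propositional using (_↭_; prep; ↭-refl; ↭-sym; ↭-trans)
open import Data.List.Relation.Binary.Permutation.Propositional.Properties using (shift; filter-↭; ↭-length)
open import Data.Vec using (Vec; []; _∷_; toList; replicate; insertAt; removeAt; lookup) renaming (map to mapᵛ)
open import Data.Vec.Properties using (zipWith-assoc; zipWith-comm; zipWith-identityˡ; zipWith-identityʳ; ∷-injective; insertAt-lookup; removeAt-insertAt; lookup-replicate; length-toList)
open import Data.Sum using (_⊎_; inj₁; inj₂)
open import Data.Product using (_×_; ∃; ∃-syntax; _,_; proj₁; proj₂)
open import Function using (_∘_; Equivalence)
open import Relation.Nullary using (Dec; yes; no; contradiction)
open import Relation.Nullary.Decidable using (_×-dec_; map′; T?)
open import Relation.Unary using (Decidable)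
open import Relation.Binary.PropositionalEquality using (_≡_; _≢_; refl; sym; trans; cong; cong₂; subst; module ≡-Reasoning)

private
  variable
    v n : ℕ

⊕-assoc : (x y z : Vect v) → (x ⊕ y) ⊕ z ≡ x ⊕ (y ⊕ z)
⊕-assoc = zipWith-assoc xor-assoc

⊕-comm : (x y : Vect v) → x ⊕ y ≡ y ⊕ x
⊕-comm = zipWith-comm xor-comm

⊕-identityˡ : (x : Vect v) → zeroV v ⊕ x ≡ x
⊕-identityˡ = zipWith-identityˡ xor-identityˡ

⊕-identityʳ : (x : Vect v) → x ⊕ zeroV v ≡ x
⊕-identityʳ = zipWith-identityʳ xor-identityʳ

⊕-self : (x : Vect v) → x ⊕ x ≡ zeroV v
⊕-self [] = refl
⊕-self (b ∷ x) = cong₂ _∷_ (xor-same b) (⊕-self x)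

⊕≡zero⇒≡ : {x y : Vect v} → x ⊕ y ≡ zeroV v → x ≡ y
⊕≡zero⇒≡ {x = x} {y} x⊕y≡0 = begin
  x                ≡⟨ sym (⊕-identityʳ x) ⟩
  x ⊕ zeroV _      ≡⟨ cong (x ⊕_) (sym (⊕-self y)) ⟩
  x ⊕ (y ⊕ y)      ≡⟨ sym (⊕-assoc x y y) ⟩
  (x ⊕ y) ⊕ y      ≡⟨ cong (_⊕ y) x⊕y≡0 ⟩
  zeroV _ ⊕ y      ≡⟨ ⊕-identityˡ y ⟩
  y                ∎
  where open ≡-Reasoning

⊕-leftComm : (x y z : Vect v) → x ⊕ (y ⊕ z) ≡ y ⊕ (x ⊕ z)
⊕-leftComm x y z = trans (sym (⊕-assoc x y z)) (trans (cong (_⊕ z) (⊕-comm x y)) (⊕-assoc y x z))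

dot-⊕ : (a x y : Vect v) → dot a (x ⊕ y) ≡ dot a x xor dot a y
dot-⊕ [] [] [] = refl
dot-⊕ (a ∷ as) (x ∷ xs) (y ∷ ys) = begin
  (a ∧ (x xor y)) xor dot as (xs ⊕ ys)              ≡⟨ cong₂ _xor_ (∧-distribˡ-xor a x y) (dot-⊕ as xs ys) ⟩
  ((a ∧ x) xor (a ∧ y)) xor (dot as xs xor dot as ys) ≡⟨ interchange (a ∧ x) (a ∧ y) (dot as xs) (dot as ys) ⟩
  ((a ∧ x) xor dot as xs) xor ((a ∧ y) xor dot as ys) ∎
  where open ≡-Reasoning

dot-zeroˡ : (x : Vect v) → dot (zeroV v) x ≡ false
dot-zeroˡ [] = refl
dot-zeroˡ (_ ∷ x) = dot-zeroˡ x

dot-zeroʳ : (a : Vect v) → dot a (zeroV v) ≡ false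
dot-zeroʳ [] = refl
dot-zeroʳ (false ∷ a) = dot-zeroʳ a
dot-zeroʳ (true ∷ a) = dot-zeroʳ a

isNonzero-zeroV : ∀ v → isNonzero (zeroV v) ≡ false
isNonzero-zeroV zero = refl
isNonzero-zeroV (suc v) = isNonzero-zeroV v

-- a unit vector at a nonzero coordinate of s
nonzero⇒non-orthogonal : (s : Vect v) → isNonzero s ≡ true →
                         ∃[ a ] (isNonzero a ≡ true × dot a s ≡ true)
nonzero⇒non-orthogonal {suc v} (true ∷ s) _ = true ∷ zeroV v , refl , cong not (dot-zeroˡ s)
nonzero⇒non-orthogonal (false ∷ s) s≢0 with nonzero⇒non-orthogonal s s≢0
... | a , a≢0 , a·s = false ∷ a , a≢0 , a·s

isNonzero-false⇒zero : (s : Vect v) → isNonzero s ≡ false → s ≡ zeroV v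
isNonzero-false⇒zero [] _ = refl
isNonzero-false⇒zero (false ∷ s) nz = cong (false ∷_) (isNonzero-false⇒zero s nz)

orthogonal-to-all⇒zero : (s : Vect v) → (∀ a → isNonzero a ≡ true → dot a s ≡ false) → s ≡ zeroV v
orthogonal-to-all⇒zero s s⊥ with isNonzero s in nz
... | false = isNonzero-false⇒zero s nz
... | true with nonzero⇒non-orthogonal s nz
...   | a , a≢0 , a·s = contradiction (trans (sym a·s) (s⊥ a a≢0)) λ ()

sumV : List (Vect v) → Vect v
sumV {v} = foldr _⊕_ (zeroV v)

χ-++ : (K L : List (Vect v)) (P : Vect v) → χ (K ++ L) P ≡ χ K P + χ L P
χ-++ K L P = trans (cong length (filter-++ (P ≟V_) K L)) (length-++ (filter (P ≟V_) K))

χ-↭ : {K L : List (Vect v)} → K ↭ L → (P : Vect v) → χ K P ≡ χ L P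
χ-↭ K↭L P = ↭-length (filter-↭ (P ≟V_) K↭L)

∈⇒1≤χ : {K : List (Vect v)} {P : Vect v} → P ∈ K → 1 ≤ χ K P
∈⇒1≤χ P∈K = ∈-length (∈-filter⁺ (_ ≟V_) P∈K refl)

χ-∷-≡ : (P : Vect v) (K : List (Vect v)) → χ (P ∷ K) P ≡ suc (χ K P)
χ-∷-≡ P K = cong length (filter-accept (P ≟V_) refl)

χ-∷-≢ : {P y : Vect v} (K : List (Vect v)) → P ≢ y → χ (y ∷ K) P ≡ χ K P
χ-∷-≢ {P = P} _ P≢y = cong length (filter-reject (P ≟V_) P≢y)

module _ (p : Vect v → Bool) where

  χ-filterᵇ-accept : (K : List (Vect v)) {P : Vect v} → p P ≡ true → χ (filterᵇ p K) P ≡ χ K P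
  χ-filterᵇ-accept [] _ = refl
  χ-filterᵇ-accept (y ∷ K) {P} pP with p y in py
  ... | true with P ≟V y
  ...   | yes _ = cong suc (χ-filterᵇ-accept K pP)
  ...   | no _  = χ-filterᵇ-accept K pP
  χ-filterᵇ-accept (y ∷ K) {P} pP | false with P ≟V y
  ...   | yes refl = contradiction (trans (sym pP) py) λ ()
  ...   | no _     = χ-filterᵇ-accept K pP

  χ-filterᵇ-reject : (K : List (Vect v)) {P : Vect v} → p P ≡ false → χ (filterᵇ p K) P ≡ 0
  χ-filterᵇ-reject [] _ = refl
  χ-filterᵇ-reject (y ∷ K) {P} pP with p y in py
  ... | false = χ-filterᵇ-reject K pP
  ... | true with P ≟V y
  ...   | yes refl = contradiction (trans (sym py) pP) λ ()
  ...   | no _     = χ-filterᵇ-reject K pP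

  χ-filterᵇ-≤ : (K : List (Vect v)) (P : Vect v) → χ (filterᵇ p K) P ≤ χ K P
  χ-filterᵇ-≤ K P with p P in pP
  ... | true  = ≤-reflexive (χ-filterᵇ-accept K pP)
  ... | false = subst (_≤ χ K P) (sym (χ-filterᵇ-reject K pP)) z≤n

χ-map-∷ : (b : Bool) (A : List (Vect v)) (P : Vect v) → χ (map (b ∷_) A) (b ∷ P) ≡ χ A P
χ-map-∷ b [] P = refl
χ-map-∷ b (y ∷ A) P = by-cases (P ≟V y)
  where
  open ≡-Reasoning
  by-cases : Dec (P ≡ y) → χ ((b ∷ y) ∷ map (b ∷_) A) (b ∷ P) ≡ χ (y ∷ A) P
  by-cases (yes refl) = begin
    χ ((b ∷ P) ∷ map (b ∷_) A) (b ∷ P) ≡⟨ χ-∷-≡ (b ∷ P) _ ⟩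
    suc (χ (map (b ∷_) A) (b ∷ P))     ≡⟨ cong suc (χ-map-∷ b A P) ⟩
    suc (χ A P)                        ≡⟨ χ-∷-≡ P A ⟨
    χ (P ∷ A) P                        ∎
  by-cases (no P≢y) = begin
    χ ((b ∷ y) ∷ map (b ∷_) A) (b ∷ P) ≡⟨ χ-∷-≢ {P = b ∷ P} _ (P≢y ∘ proj₂ ∘ ∷-injective) ⟩
    χ (map (b ∷_) A) (b ∷ P)           ≡⟨ χ-map-∷ b A P ⟩
    χ A P                              ≡⟨ χ-∷-≢ A P≢y ⟨
    χ (y ∷ A) P                        ∎

χ-map-∷-≢ : {b b′ : Bool} → b′ ≢ b → (A : List (Vect v)) (P : Vect v) → χ (map (b ∷_) A) (b′ ∷ P) ≡ 0
χ-map-∷-≢ b′≢b [] P = refl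
χ-map-∷-≢ {b′ = b′} b′≢b (y ∷ A) P =
  trans (χ-∷-≢ {P = b′ ∷ P} _ (b′≢b ∘ proj₁ ∘ ∷-injective)) (χ-map-∷-≢ b′≢b A P)

χ-allVects : ∀ v (P : Vect v) → χ (allVects v) P ≡ 1
χ-allVects zero [] = refl
χ-allVects (suc v) (false ∷ P) = trans (χ-++ (map (false ∷_) (allVects v)) _ _)
  (cong₂ _+_ (trans (χ-map-∷ false (allVects v) P) (χ-allVects v P)) (χ-map-∷-≢ (λ ()) (allVects v) P))
χ-allVects (suc v) (true ∷ P) = trans (χ-++ (map (false ∷_) (allVects v)) _ _)
  (cong₂ _+_ (χ-map-∷-≢ (λ ()) (allVects v) P) (trans (χ-map-∷ true (allVects v) P) (χ-allVects v P)))

χ-points : (P : Vect v) → isNonzero P ≡ true → χ (points v) P ≡ 1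
χ-points {v} P P≢0 = trans (χ-filterᵇ-accept isNonzero (allVects v) P≢0) (χ-allVects v P)

χ-points-zeroV : ∀ v → χ (points v) (zeroV v) ≡ 0
χ-points-zeroV v = χ-filterᵇ-reject isNonzero (allVects v) (isNonzero-zeroV v)

isOdd : ℕ → Bool
isOdd zero    = false
isOdd (suc n) = not (isOdd n)

isOdd-+ : ∀ m n → isOdd (m + n) ≡ isOdd m xor isOdd n
isOdd-+ zero    n = refl
isOdd-+ (suc m) n = trans (cong not (isOdd-+ m n)) (not-distribˡ-xor (isOdd m) (isOdd n))

isOdd-*2 : ∀ q → isOdd (q * 2) ≡ false
isOdd-*2 zero    = refl
isOdd-*2 (suc q) = trans (not-involutive (isOdd (q * 2))) (isOdd-*2 q)

isOdd-even : {m : ℕ} → 2 ∣ m → isOdd m ≡ false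
isOdd-even (divides q refl) = isOdd-*2 q

sum-map-filterᵇ-split : {A : Set} (f : A → ℕ) (p : A → Bool) (L : List A) →
  sum (map f L) ≡ sum (map f (filterᵇ (not ∘ p) L)) + sum (map f (filterᵇ p L))
sum-map-filterᵇ-split f p [] = refl
sum-map-filterᵇ-split f p (y ∷ L) with p y
... | true  = trans (cong (f y +_) (sum-map-filterᵇ-split f p L)) (+-leftComm (f y) off on)
  where off = sum (map f (filterᵇ (not ∘ p) L)); on = sum (map f (filterᵇ p L))
... | false = trans (cong (f y +_) (sum-map-filterᵇ-split f p L)) (sym (+-assoc (f y) off on))
  where off = sum (map f (filterᵇ (not ∘ p) L)); on = sum (map f (filterᵇ p L))

-- for a multiset with multiplicities ≤ 1 these are exactly its points
oddSupport : Multiset v → List (Vect v)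
oddSupport {v} M = filterᵇ (isOdd ∘ M) (points v)

dot-sumV-filter-isOdd : (M : Multiset v) (a : Vect v) (L : List (Vect v)) →
  dot a (sumV (filterᵇ (isOdd ∘ M) L)) ≡ isOdd (sum (map M (filterᵇ (dot a) L)))
dot-sumV-filter-isOdd M a [] = dot-zeroʳ a
dot-sumV-filter-isOdd M a (y ∷ L)
  with isOdd (M y) in odd | dot a y in a·y | dot-sumV-filter-isOdd M a L
... | true  | true  | IH = trans (dot-⊕ a y _)
  (trans (cong₂ _xor_ (trans a·y (sym odd)) IH) (sym (isOdd-+ (M y) _)))
... | true  | false | IH = trans (dot-⊕ a y _) (trans (cong (_xor _) a·y) IH)
... | false | true  | IH = trans IH (sym (trans (isOdd-+ (M y) _) (cong (_xor _) odd)))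
... | false | false | IH = IH

divisible⇒sumV-oddSupport≡0 : (M : Multiset v) → Divisible 2 M → 2 ∣ card M →
                            sumV (oddSupport M) ≡ zeroV v
divisible⇒sumV-oddSupport≡0 {v} M div 2∣card = orthogonal-to-all⇒zero _ λ a a≢0 →
  trans (dot-sumV-filter-isOdd M a (points v)) (isOdd-even (2∣off a a≢0))
  where
  2∣off : ∀ a → isNonzero a ≡ true → 2 ∣ sum (map M (filterᵇ (dot a) (points v)))
  2∣off a a≢0 = ∣m+n∣m⇒∣n
    (subst (2 ∣_) (sum-map-filterᵇ-split M (dot a) (points v)) 2∣card)
    (m%n≡0⇒n∣m _ 2 (trans (div a a≢0) (n∣m⇒m%n≡0 (card M) 2 2∣card)))

-- agreement on the points of PG(v-1,2): the value of a multiset at the zero vector is junk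
_≐_ : Multiset v → Multiset v → Set
_≐_ {v} M N = ∀ (P : Vect v) → isNonzero P ≡ true → M P ≡ N P

record IsPointSet {v} (K : List (Vect v)) : Set where
  constructor pointSet
  field
    zero∉ : χ K (zeroV v) ≡ 0
    χ≤1   : ∀ P → χ K P ≤ 1

IsPointSet-≤ : {K L : List (Vect v)} → (∀ P → χ K P ≤ χ L P) → IsPointSet L → IsPointSet K
IsPointSet-≤ {v} K≤L (pointSet zero∉L L≤1) =
  pointSet (n≤0⇒n≡0 (≤-trans (K≤L (zeroV v)) (≤-reflexive zero∉L))) λ P → ≤-trans (K≤L P) (L≤1 P)

points-isPointSet : IsPointSet (points v)
points-isPointSet {v} =
  pointSet (χ-points-zeroV v) λ P → ≤-trans (χ-filterᵇ-≤ isNonzero (allVects v) P) (≤-reflexive (χ-allVects v P))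

oddSupport-isPointSet : (M : Multiset v) → IsPointSet (oddSupport M)
oddSupport-isPointSet {v} M = IsPointSet-≤ (χ-filterᵇ-≤ (isOdd ∘ M) (points v)) points-isPointSet

IsPointSet-++ˡ : (K L : List (Vect v)) → IsPointSet (K ++ L) → IsPointSet K
IsPointSet-++ˡ K L = IsPointSet-≤ λ P → subst (χ K P ≤_) (sym (χ-++ K L P)) (m≤m+n _ _)

IsPointSet-++ʳ : (K L : List (Vect v)) → IsPointSet (K ++ L) → IsPointSet L
IsPointSet-++ʳ K L = IsPointSet-≤ λ P → subst (χ L P ≤_) (sym (χ-++ K L P)) (m≤n+m _ _)

IsPointSet-↭ : {K L : List (Vect v)} → K ↭ L → IsPointSet L → IsPointSet K
IsPointSet-↭ K↭L = IsPointSet-≤ λ P → ≤-reflexive (χ-↭ K↭L P)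

IsPointSet⇒nonzero : {K : List (Vect v)} {x : Vect v} → IsPointSet K → x ∈ K → x ≢ zeroV v
IsPointSet⇒nonzero (pointSet zero∉ _) x∈K refl = n≮0 (subst (1 ≤_) zero∉ (∈⇒1≤χ x∈K))

IsPointSet⇒distinct : {x y : Vect v} (K : List (Vect v)) → IsPointSet (x ∷ y ∷ K) → x ≢ y
IsPointSet⇒distinct {x = x} K (pointSet _ χ≤1) refl with
  subst (_≤ 1) (trans (χ-∷-≡ x (x ∷ K)) (cong suc (χ-∷-≡ x K))) (χ≤1 x)
... | s≤s ()

IsPointSet⇒Disjoint : (K L : List (Vect v)) → IsPointSet (K ++ L) → Disjoint K L
IsPointSet⇒Disjoint K L (pointSet _ χ≤1) P P∈K P∈L with
  subst (_≤ 1) (χ-++ K L P) (χ≤1 P) | ∈⇒1≤χ P∈K | ∈⇒1≤χ P∈L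
... | K+L≤1 | 1≤K | 1≤L = n≮0 (+-cancelˡ-≤ 1 _ _ (≤-trans (+-mono-≤ 1≤K 1≤L) K+L≤1))

LinIndep-pair : {a b : Vect v} → a ≢ zeroV v → b ≢ zeroV v → a ≢ b → LinIndep (a ∷ b ∷ [])
LinIndep-pair a≢0 b≢0 a≢b (false ∷ false ∷ []) _ = refl
LinIndep-pair {a = a} a≢0 b≢0 a≢b (true ∷ false ∷ []) a+0≡0 = contradiction (trans (sym (⊕-identityʳ a)) a+0≡0) a≢0
LinIndep-pair {b = b} a≢0 b≢0 a≢b (false ∷ true ∷ []) b+0≡0 = contradiction (trans (sym (⊕-identityʳ b)) b+0≡0) b≢0
LinIndep-pair {b = b} a≢0 b≢0 a≢b (true ∷ true ∷ []) a+b≡0 = contradiction (trans (⊕≡zero⇒≡ a+b≡0) (⊕-identityʳ b)) a≢b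

zeroSum-size : (K : List (Vect v)) → IsPointSet K → sumV K ≡ zeroV v → length K ≡ 0 ⊎ 3 ≤ length K
zeroSum-size [] _ _ = inj₁ refl
zeroSum-size (x ∷ []) pts x+0≡0 =
  contradiction (trans (sym (⊕-identityʳ x)) x+0≡0) (IsPointSet⇒nonzero pts (here refl))
zeroSum-size (x ∷ y ∷ []) pts x+y≡0 =
  contradiction (trans (⊕≡zero⇒≡ x+y≡0) (⊕-identityʳ y)) (IsPointSet⇒distinct [] pts)
zeroSum-size (x ∷ y ∷ z ∷ K) _ _ = inj₂ (s≤s (s≤s (s≤s z≤n)))

zeroSum-triple-line : {a b e : Vect v} → IsPointSet (a ∷ b ∷ e ∷ []) → sumV (a ∷ b ∷ e ∷ []) ≡ zeroV v →
                      LinIndep (a ∷ b ∷ []) × e ≡ a ⊕ b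
zeroSum-triple-line {a = a} {b} {e} pts sum≡0 =
  LinIndep-pair (IsPointSet⇒nonzero pts (here refl)) (IsPointSet⇒nonzero pts (there (here refl)))
                (IsPointSet⇒distinct (e ∷ []) pts) , e≡a⊕b
  where
  open ≡-Reasoning
  a≡b⊕e : a ≡ b ⊕ e
  a≡b⊕e = trans (⊕≡zero⇒≡ sum≡0) (cong (b ⊕_) (⊕-identityʳ e))
  e≡a⊕b : e ≡ a ⊕ b
  e≡a⊕b = begin
    e                ≡⟨ ⊕-identityˡ e ⟨
    zeroV _ ⊕ e      ≡⟨ cong (_⊕ e) (⊕-self b) ⟨
    (b ⊕ b) ⊕ e      ≡⟨ ⊕-assoc b b e ⟩
    b ⊕ (b ⊕ e)      ≡⟨ cong (b ⊕_) a≡b⊕e ⟨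
    b ⊕ a            ≡⟨ ⊕-comm b a ⟩
    a ⊕ b            ∎

sum-map-≤1 : {A : Set} (f : A → ℕ) (L : List A) → All (λ x → f x ≤ 1) L →
             sum (map f L) ≡ length (filterᵇ (isOdd ∘ f) L)
sum-map-≤1 f [] [] = refl
sum-map-≤1 f (y ∷ L) (fy≤1 ∷ L≤1) with f y | fy≤1
... | 0 | _ = sum-map-≤1 f L L≤1
... | 1 | _ = cong suc (sum-map-≤1 f L L≤1)
... | suc (suc _) | s≤s ()

module _ (M : Multiset v) (simple : ∀ P → isNonzero P ≡ true → M P ≤ 1) where

  χ-oddSupport : M ≐ χ (oddSupport M)
  χ-oddSupport P P≢0 with M P in MP | simple P P≢0
  ... | 0 | _ = sym (χ-filterᵇ-reject (isOdd ∘ M) (points v) (cong isOdd MP))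
  ... | 1 | _ = sym (trans (χ-filterᵇ-accept (isOdd ∘ M) (points v) (cong isOdd MP)) (χ-points P P≢0))
  ... | suc (suc _) | s≤s ()

  length-oddSupport : length (oddSupport M) ≡ card M
  length-oddSupport = sym (sum-map-≤1 M (points v)
    (All.map (λ {P} P≢0 → simple P (Equivalence.to (T-≡ {isNonzero P}) P≢0)) (all-filter (T? ∘ isNonzero) (allVects v))))

any-Vec-Bool? : ∀ n {Q : Vec Bool n → Set} → Decidable Q → Dec (∃ Q)
any-Vec-Bool? zero    Q? = map′ ([] ,_) (λ { ([] , q) → q }) (Q? [])
any-Vec-Bool? (suc n) Q? with any-Vec-Bool? n (Q? ∘ (false ∷_)) | any-Vec-Bool? n (Q? ∘ (true ∷_))
... | yes (c , q) | _           = yes (false ∷ c , q)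
... | no _        | yes (c , q) = yes (true ∷ c , q)
... | no ∄false   | no ∄true    = no λ where
  (false ∷ c , q) → ∄false (c , q)
  (true  ∷ c , q) → ∄true (c , q)

select : {A : Set} → Vec Bool n → Vec A n → List A
select []           []       = []
select (true  ∷ c) (x ∷ xs) = x ∷ select c xs
select (false ∷ c) (x ∷ xs) = select c xs

module _ {A : Set} where

  select-↭ : (c : Vec Bool n) (xs : Vec A n) → toList xs ↭ select c xs ++ select (mapᵛ not c) xs
  select-↭ [] [] = ↭-refl
  select-↭ (true  ∷ c) (x ∷ xs) = prep x (select-↭ c xs)
  select-↭ (false ∷ c) (x ∷ xs) = ↭-trans (prep x (select-↭ c xs)) (↭-sym (shift x (select c xs) _))

  length-select : (c : Vec Bool n) (xs : Vec A n) → length (select c xs) + length (select (mapᵛ not c) xs) ≡ n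
  length-select c xs = begin
    length (select c xs) + length (select (mapᵛ not c) xs) ≡⟨ length-++ (select c xs) ⟨
    length (select c xs ++ select (mapᵛ not c) xs)         ≡⟨ ↭-length (select-↭ c xs) ⟨
    length (toList xs)                                     ≡⟨ length-toList xs ⟩
    _                                                      ∎
    where open ≡-Reasoning

  length-select≡0⇒all-false : (c : Vec Bool n) (xs : Vec A n) → length (select c xs) ≡ 0 → c ≡ replicate n false
  length-select≡0⇒all-false []          []       _ = refl
  length-select≡0⇒all-false (false ∷ c) (x ∷ xs) e = cong (false ∷_) (length-select≡0⇒all-false c xs e)

  length-select-not≡0⇒all-true : (c : Vec Bool n) (xs : Vec A n) → length (select (mapᵛ not c) xs) ≡ 0 → c ≡ replicate n true
  length-select-not≡0⇒all-true []         []       _ = refl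
  length-select-not≡0⇒all-true (true ∷ c) (x ∷ xs) e = cong (true ∷_) (length-select-not≡0⇒all-true c xs e)

lincomb-select : (c : Vec Bool n) (xs : Vec (Vect v) n) → lincomb c xs ≡ sumV (select c xs)
lincomb-select []          []       = refl
lincomb-select (true  ∷ c) (x ∷ xs) = cong (x ⊕_) (lincomb-select c xs)
lincomb-select (false ∷ c) (x ∷ xs) = lincomb-select c xs

lincomb-complement : (c : Vec Bool n) (xs : Vec (Vect v) n) → lincomb c xs ⊕ lincomb (mapᵛ not c) xs ≡ sumV (toList xs)
lincomb-complement {v = v} [] [] = ⊕-identityʳ (zeroV v)
lincomb-complement (true ∷ c) (x ∷ xs) =
  trans (⊕-assoc x _ _) (cong (x ⊕_) (lincomb-complement c xs))
lincomb-complement (false ∷ c) (x ∷ xs) =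
  trans (⊕-leftComm (lincomb c xs) x _) (cong (x ⊕_) (lincomb-complement c xs))

lincomb-insertAt : (c : Vec Bool n) (xs : Vec (Vect v) (suc n)) (i : Fin (suc n)) →
                   lincomb (insertAt c i false) xs ≡ lincomb c (removeAt xs i)
lincomb-insertAt c           (x ∷ xs)     zero    = refl
lincomb-insertAt (false ∷ c) (x ∷ y ∷ xs) (suc i) = lincomb-insertAt c (y ∷ xs) i
lincomb-insertAt (true  ∷ c) (x ∷ y ∷ xs) (suc i) = cong (x ⊕_) (lincomb-insertAt c (y ∷ xs) i)

removeAt-replicate : {A : Set} {x : A} (i : Fin (suc n)) → removeAt (replicate (suc n) x) i ≡ replicate n x
removeAt-replicate                  zero    = refl
removeAt-replicate {n = suc n} {x = x} (suc i) = cong (x ∷_) (removeAt-replicate i)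

trivial-relations⇒ProjectiveBase : (xs : Vec (Vect v) (suc n)) →
  (∀ c → lincomb c xs ≡ zeroV v → c ≡ replicate _ false ⊎ c ≡ replicate _ true) → ProjectiveBase xs
trivial-relations⇒ProjectiveBase {n = n} xs trivial i c rel
  with trivial (insertAt c i false) (trans (lincomb-insertAt c xs i) rel)
... | inj₁ all-false = begin
  c                                     ≡⟨ removeAt-insertAt c i false ⟨
  removeAt (insertAt c i false) i       ≡⟨ cong (λ d → removeAt d i) all-false ⟩
  removeAt (replicate (suc n) false) i  ≡⟨ removeAt-replicate i ⟩
  replicate n false                     ∎
  where open ≡-Reasoning
... | inj₂ all-true = contradiction (begin
  false                                 ≡⟨ insertAt-lookup c i false ⟨
  lookup (insertAt c i false) i         ≡⟨ cong (λ d → lookup d i) all-true ⟩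
  lookup (replicate (suc n) true) i     ≡⟨ lookup-replicate i true ⟩
  true                                  ∎) λ ()
  where open ≡-Reasoning

IsCharOfProjectiveBase : Multiset v → Set
IsCharOfProjectiveBase {v} M = ∃[ b ] (ProjectiveBase {v} {5} b × M ≐ χ (toList b))

IsCharOfTwoDisjointLines : Multiset v → Set
IsCharOfTwoDisjointLines {v} M = ∃[ a ] ∃[ b ] ∃[ c ] ∃[ d ]
  (LinIndep {v} (a ∷ b ∷ []) × LinIndep {v} (c ∷ d ∷ []) × Disjoint (linePoints a b) (linePoints c d)
   × M ≐ λ P → χ (linePoints a b) P + χ (linePoints c d) P)

zeroSum-triples⇒lines : (M : Multiset v) (K L : List (Vect v)) → length K ≡ 3 → length L ≡ 3 →
  IsPointSet (K ++ L) → sumV K ≡ zeroV v → sumV L ≡ zeroV v → M ≐ χ (K ++ L) → IsCharOfTwoDisjointLines M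
zeroSum-triples⇒lines M (a ∷ b ∷ e ∷ []) (c ∷ d ∷ f ∷ []) refl refl pts K≡0 L≡0 M≐K+L
  with zeroSum-triple-line (IsPointSet-++ˡ (a ∷ b ∷ e ∷ []) _ pts) K≡0
     | zeroSum-triple-line (IsPointSet-++ʳ (a ∷ b ∷ e ∷ []) _ pts) L≡0
... | ab-indep , refl | cd-indep , refl =
  a , b , c , d , ab-indep , cd-indep , IsPointSet⇒Disjoint (linePoints a b) (linePoints c d) pts ,
  λ P P≢0 → trans (M≐K+L P P≢0) (χ-++ (linePoints a b) (linePoints c d) P)

complement-relation : (c : Vec Bool n) (xs : Vec (Vect v) n) → sumV (toList xs) ≡ zeroV v →
                      lincomb c xs ≡ zeroV v → lincomb (mapᵛ not c) xs ≡ zeroV v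
complement-relation {v = v} c xs sum≡0 rel = begin
  lincomb (mapᵛ not c) xs                ≡⟨ ⊕-identityˡ _ ⟨
  zeroV v ⊕ lincomb (mapᵛ not c) xs      ≡⟨ cong (_⊕ lincomb (mapᵛ not c) xs) rel ⟨
  lincomb c xs ⊕ lincomb (mapᵛ not c) xs ≡⟨ lincomb-complement c xs ⟩
  sumV (toList xs)                       ≡⟨ sum≡0 ⟩
  zeroV v                                ∎
  where open ≡-Reasoning

select-isPointSet : (c : Vec Bool n) (xs : Vec (Vect v) n) → IsPointSet (toList xs) →
                    IsPointSet (select c xs ++ select (mapᵛ not c) xs)
select-isPointSet c xs = IsPointSet-↭ (↭-sym (select-↭ c xs))

select-zeroSum : (c : Vec Bool n) (xs : Vec (Vect v) n) → lincomb c xs ≡ zeroV v → sumV (select c xs) ≡ zeroV v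
select-zeroSum c xs rel = trans (sym (lincomb-select c xs)) rel

m+n≡6⇒m≡3 : ∀ {k k′} → k + k′ ≡ 6 → 3 ≤ k → 3 ≤ k′ → k ≡ 3
m+n≡6⇒m≡3 {k} k+k′≡6 3≤k 3≤k′ =
  ≤-antisym (+-cancelʳ-≤ 3 k 3 (≤-trans (+-monoʳ-≤ k 3≤k′) (≤-reflexive k+k′≡6))) 3≤k

zeroSum-relations : (xs : Vec (Vect v) 6) → IsPointSet (toList xs) → sumV (toList xs) ≡ zeroV v →
  (c : Vec Bool 6) → lincomb c xs ≡ zeroV v →
  c ≡ replicate 6 false ⊎ c ≡ replicate 6 true ⊎ length (select c xs) ≡ 3
zeroSum-relations xs pts sum≡0 c rel
  with zeroSum-size (select c xs) (IsPointSet-++ˡ _ _ split) (select-zeroSum c xs rel)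
     | zeroSum-size (select (mapᵛ not c) xs) (IsPointSet-++ʳ (select c xs) _ split)
                    (select-zeroSum (mapᵛ not c) xs (complement-relation c xs sum≡0 rel))
  where split = select-isPointSet c xs pts
... | inj₁ k≡0  | _          = inj₁ (length-select≡0⇒all-false c xs k≡0)
... | inj₂ _    | inj₁ k′≡0  = inj₂ (inj₁ (length-select-not≡0⇒all-true c xs k′≡0))
... | inj₂ 3≤k  | inj₂ 3≤k′  = inj₂ (inj₂ (m+n≡6⇒m≡3 (length-select c xs) 3≤k 3≤k′))

zeroSum-six-points : (M : Multiset v) (xs : Vec (Vect v) 6) → IsPointSet (toList xs) →
  sumV (toList xs) ≡ zeroV v → M ≐ χ (toList xs) → IsCharOfProjectiveBase M ⊎ IsCharOfTwoDisjointLines M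
zeroSum-six-points M xs pts sum≡0 M≐xs
  with any-Vec-Bool? 6 (λ c → (length (select c xs) ≟ 3) ×-dec (lincomb c xs ≟V zeroV _))
... | yes (c , k≡3 , rel) =
  inj₂ (zeroSum-triples⇒lines M (select c xs) (select (mapᵛ not c) xs) k≡3 k′≡3
          (select-isPointSet c xs pts) (select-zeroSum c xs rel)
          (select-zeroSum (mapᵛ not c) xs (complement-relation c xs sum≡0 rel))
          λ P P≢0 → trans (M≐xs P P≢0) (χ-↭ (select-↭ c xs) P))
  where
  k′≡3 : length (select (mapᵛ not c) xs) ≡ 3
  k′≡3 = +-cancelˡ-≡ 3 _ _ (subst (λ k → k + length (select (mapᵛ not c) xs) ≡ 6) k≡3 (length-select c xs))
... | no ∄triple = inj₁ (xs , trivial-relations⇒ProjectiveBase xs trivial , M≐xs)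
  where
  trivial : ∀ c → lincomb c xs ≡ zeroV _ → c ≡ replicate 6 false ⊎ c ≡ replicate 6 true
  trivial c rel with zeroSum-relations xs pts sum≡0 c rel
  ... | inj₁ all-false        = inj₁ all-false
  ... | inj₂ (inj₁ all-true)  = inj₂ all-true
  ... | inj₂ (inj₂ k≡3)       = contradiction (c , k≡3 , rel) ∄triple

zeroSum-six-point-list : (M : Multiset v) (S : List (Vect v)) → length S ≡ 6 → IsPointSet S →
  sumV S ≡ zeroV v → M ≐ χ S → IsCharOfProjectiveBase M ⊎ IsCharOfTwoDisjointLines M
zeroSum-six-point-list M (x₁ ∷ x₂ ∷ x₃ ∷ x₄ ∷ x₅ ∷ x₆ ∷ []) refl =
  zeroSum-six-points M (x₁ ∷ x₂ ∷ x₃ ∷ x₄ ∷ x₅ ∷ x₆ ∷ [])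

proposition17 : (v : ℕ) (M : Multiset v) → Divisible 2 M → card M ≡ 6 →
      (∃[ P ] (isNonzero P ≡ true × 2 ≤ M P))
    ⊎ (∃[ b ] (ProjectiveBase {v} {5} b
                × (∀ P → isNonzero P ≡ true → M P ≡ χ (toList b) P)))
    ⊎ (∃[ a ] ∃[ b ] ∃[ c ] ∃[ d ]
         (LinIndep {v} (a ∷ b ∷ []) × LinIndep {v} (c ∷ d ∷ [])
          × Disjoint (linePoints a b) (linePoints c d)
          × (∀ P → isNonzero P ≡ true →
               M P ≡ χ (linePoints a b) P + χ (linePoints c d) P)))
proposition17 v M div card≡6
  with any-Vec-Bool? v (λ P → (isNonzero P Bool.≟ true) ×-dec (2 ≤? M P))
... | yes multiple-point = inj₁ multiple-point
... | no ∄multiple-point = inj₂ (zeroSum-six-point-list M (oddSupport M)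
        (trans (length-oddSupport M simple) card≡6)
        (oddSupport-isPointSet M)
        (divisible⇒sumV-oddSupport≡0 M div (subst (2 ∣_) (sym card≡6) (divides 3 refl)))
        (χ-oddSupport M simple))
  where
  simple : ∀ P → isNonzero P ≡ true → M P ≤ 1
  simple P P≢0 = ≤-pred (≰⇒> λ 2≤MP → ∄multiple-point (P , P≢0 , 2≤MP))
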